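{- Let $n>1$ be odd, let $\alpha,\beta\geq 1$ be integers with $\alpha+\beta$ even, and let $\Gamma\cong \mathbb{Z}_{4n^{\alpha}}\oplus \mathbb{Z}_{n^{\beta}}$. Then there exists a $\Gamma$-magic square $\mathrm{MS}_{\Gamma}(2n^{(\alpha+\beta)/2})$ of side $2n^{(\alpha+\beta)/2}$.
   Context: For an Abelian group $(\Gamma,+)$ of order $N^2$, a $\Gamma$-magic square $\mathrm{MS}_{\Gamma}(N)$ (of side $N$) is an $N\times N$ array whose entries are all the elements of $\Gamma$ (each element appearing exactly once) such that all row sums, all column sums, the sum along the main diagonal and the sum along the backward main diagonal are equal to the same element $\mu\in\Gamma$. $\mathbb{Z}_r$ denotes the cyclic group of order $r$. -}

module Defs where

open import Data.Nat using (ℕ; zero; suc; _+_; _*_; _^_; NonZero)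
open import Data.Nat.DivMod using (_%_; m%n<n)
import Data.Fin
open import Data.Fin using (Fin; toℕ; fromℕ<)
open import Data.Product using (_×_; _,_; Σ)
open import Relation.Binary.PropositionalEquality using (_≡_)
open import Function.Definitions using (Bijective)

addMod : (m : ℕ) .{{_ : NonZero m}} → Fin m → Fin m → Fin m
addMod m a b = fromℕ< (m%n<n (toℕ a + toℕ b) m)

zeroMod : (m : ℕ) .{{_ : NonZero m}} → Fin m
zeroMod m = fromℕ< (m%n<n 0 m)

ZZ : ℕ → ℕ → Set
ZZ m₁ m₂ = Fin m₁ × Fin m₂

addZZ : (m₁ m₂ : ℕ) .{{_ : NonZero m₁}} .{{_ : NonZero m₂}} →
        ZZ m₁ m₂ → ZZ m₁ m₂ → ZZ m₁ m₂
addZZ m₁ m₂ (a₁ , a₂) (b₁ , b₂) = addMod m₁ a₁ b₁ , addMod m₂ a₂ b₂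

zeroZZ : (m₁ m₂ : ℕ) .{{_ : NonZero m₁}} .{{_ : NonZero m₂}} → ZZ m₁ m₂
zeroZZ m₁ m₂ = zeroMod m₁ , zeroMod m₂

sumZZ : (m₁ m₂ : ℕ) .{{_ : NonZero m₁}} .{{_ : NonZero m₂}} →
        (N : ℕ) → (Fin N → ZZ m₁ m₂) → ZZ m₁ m₂
sumZZ m₁ m₂ zero f = zeroZZ m₁ m₂
sumZZ m₁ m₂ (suc N) f = addZZ m₁ m₂ (f Fin.zero) (sumZZ m₁ m₂ N (λ i → f (Fin.suc i)))

rev : {N : ℕ} → Fin N → Fin N
rev = Data.Fin.opposite

record MagicSquare (m₁ m₂ : ℕ) .{{_ : NonZero m₁}} .{{_ : NonZero m₂}} (N : ℕ) : Set where
  field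
    entry   : Fin N × Fin N → ZZ m₁ m₂
    bij     : Bijective _≡_ _≡_ entry
    μ       : ZZ m₁ m₂
    rows    : ∀ i → sumZZ m₁ m₂ N (λ j → entry (i , j)) ≡ μ
    cols    : ∀ j → sumZZ m₁ m₂ N (λ i → entry (i , j)) ≡ μ
    diag    : sumZZ m₁ m₂ N (λ i → entry (i , i)) ≡ μ
    antidiag : sumZZ m₁ m₂ N (λ i → entry (i , rev i)) ≡ μ

-- Conway's LUX construction, carried out in ℤ_{4P} ⊕ ℤ_Q with P = n^α, Q = n^β and M = n^k odd,
-- so that P Q = M².  The square of side 2M is an M × M array of 2 × 2 blocks.  Block (p , q) carries
-- the pair (A p q , B p q) of two orthogonal cyclic Latin squares of order M: every row, column and
-- diagonal of A and of B runs through 0 … M-1 (on the diagonal because 2 is invertible modulo the odd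
-- M), except the antidiagonal of A and the diagonal of B, which are constant (M-1)/2 with the same sum.
-- Since P Q = M², a mixed-radix linear map sends these pairs injectively into ℤ_P ⊕ ℤ_Q.  The four
-- cells of a block are told apart by a digit c < 4 placed in the L, U or X pattern and stored as
-- c + 4 ℓ in ℤ_{4P}; Conway's arrangement of the letters makes the digits along every line add up
-- to 3M.  So all line sums agree, and the 4M² entries are pairwise distinct, hence exhaust the group.

module Submission where

open import Algebra.Properties.CommutativeMonoid.Sum as MonoidSum using ()
open import Data.Bool.Base using (Bool; true; false; if_then_else_)
import Data.Fin.Base as Fin
open import Data.Fin.Base using (Fin; toℕ; fromℕ<; combine; remQuot; punchOut)
open import Data.Fin.Patterns using (0F; 1F; 2F; 3F)
open import Data.Fin.Properties
  using (toℕ-fromℕ<; toℕ<n; opposite-prop; toℕ-injective; any?; punchOut-injective; injective⇒≤;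
         remQuot-combine; combine-remQuot)
  renaming (_≟_ to _≟ᶠ_)
open import Data.Nat.Base
open import Data.Nat.DivMod hiding (_mod_)
open import Data.Nat.Properties
open import Data.Nat.Tactic.RingSolver using (solve-∀)
open import Data.Product.Base using (∃; ∃₂; _×_; _,_; proj₁; proj₂; uncurry)
open import Function.Base using (_∘_; id)
open import Function.Bundles using (mk⤖)
open import Function.Definitions using (Injective; Surjective)
open import Function.Properties.Bijection using (⤖⇒↔)
open import Relation.Binary.PropositionalEquality
open import Relation.Nullary using (yes; no; contradiction; does)
open import Relation.Nullary.Decidable using (dec-true; dec-false)
open import Algebra.Properties.CommutativeSemigroup +-commutativeSemigroup using (interchange; xy∙z≈xz∙y)

open import Defs

open ≡-Reasoning
module Sumℕ = MonoidSum +-0-commutativeMonoid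

∑ : ℕ → (ℕ → ℕ) → ℕ
∑ zero    f = 0
∑ (suc n) f = f 0 + ∑ n (f ∘ suc)

syntax ∑ n (λ t → e) = ∑[ t < n ] e

∑-cong : ∀ n {f g : ℕ → ℕ} → (∀ {t} → t < n → f t ≡ g t) → ∑ n f ≡ ∑ n g
∑-cong zero    f≗g = refl
∑-cong (suc n) f≗g = cong₂ _+_ (f≗g z<s) (∑-cong n (f≗g ∘ s<s))

∑-split : ∀ m n (f : ℕ → ℕ) → ∑ (m + n) f ≡ ∑ m f + ∑[ t < n ] f (m + t)
∑-split zero    n f = refl
∑-split (suc m) n f = trans (cong (f 0 +_) (∑-split m n (f ∘ suc))) (sym (+-assoc (f 0) _ _))

∑-last : ∀ n (f : ℕ → ℕ) → ∑ (suc n) f ≡ ∑ n f + f n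
∑-last zero    f = +-comm (f 0) 0
∑-last (suc n) f = trans (cong (f 0 +_) (∑-last n (f ∘ suc))) (sym (+-assoc (f 0) _ _))

∑-const : ∀ n k → ∑[ _ < n ] k ≡ n * k
∑-const zero    k = refl
∑-const (suc n) k = cong (k +_) (∑-const n k)

∑-distrib-+ : ∀ n (f g : ℕ → ℕ) → ∑[ t < n ] (f t + g t) ≡ ∑ n f + ∑ n g
∑-distrib-+ zero    f g = refl
∑-distrib-+ (suc n) f g = trans (cong (f 0 + g 0 +_) (∑-distrib-+ n (f ∘ suc) (g ∘ suc)))
                                (interchange (f 0) (g 0) _ _)

∑-*ˡ : ∀ n k (f : ℕ → ℕ) → ∑[ t < n ] (k * f t) ≡ k * ∑ n f
∑-*ˡ zero    k f = sym (*-zeroʳ k)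
∑-*ˡ (suc n) k f = trans (cong (k * f 0 +_) (∑-*ˡ n k (f ∘ suc))) (sym (*-distribˡ-+ k (f 0) _))

∑-gauss : ∀ n → ∑[ t < n ] t * 2 + n ≡ n * n
∑-gauss zero    = refl
∑-gauss (suc n) = begin
  ∑[ t < suc n ] t * 2 + suc n  ≡⟨ cong (λ s → s * 2 + suc n) (∑-last n id) ⟩
  (∑ n id + n) * 2 + suc n      ≡⟨ shuffle (∑ n id) n ⟩
  ∑ n id * 2 + n + (n + n + 1)  ≡⟨ cong (_+ (n + n + 1)) (∑-gauss n) ⟩
  n * n + (n + n + 1)           ≡⟨ square-suc n ⟩
  suc n * suc n                 ∎
  where shuffle : ∀ s n → (s + n) * 2 + suc n ≡ s * 2 + n + (n + n + 1)
        shuffle = solve-∀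
        square-suc : ∀ n → n * n + (n + n + 1) ≡ suc n * suc n
        square-suc = solve-∀

∑≡sum : ∀ n (f : ℕ → ℕ) → ∑ n f ≡ Sumℕ.sum {n} (f ∘ toℕ)
∑≡sum zero    f = refl
∑≡sum (suc n) f = cong (f 0 +_) (∑≡sum n (f ∘ suc))

injective⇒surjective : ∀ {m n} {f : Fin m → Fin n} → m ≡ n →
                       Injective _≡_ _≡_ f → Surjective _≡_ _≡_ f
injective⇒surjective {zero}  refl f-inj ()
injective⇒surjective {suc n} {f = f} refl f-inj y with any? (λ x → f x ≟ᶠ y)
... | yes (x , fx≡y) = x , λ { refl → fx≡y }
... | no ∄x = contradiction (injective⇒≤ punched-injective) 1+n≰n
  where
  y≢f : ∀ x → y ≢ f x
  y≢f x y≡fx = ∄x (x , sym y≡fx)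
  punched : Fin (suc n) → Fin n
  punched x = punchOut (y≢f x)
  punched-injective : Injective _≡_ _≡_ punched
  punched-injective = f-inj ∘ punchOut-injective (y≢f _) (y≢f _)

injective⇒surjective-× : ∀ {a b c d} {f : Fin a × Fin b → Fin c × Fin d} → a * b ≡ c * d →
                         Injective _≡_ _≡_ f → Surjective _≡_ _≡_ f
injective⇒surjective-× {a} {b} {c} {d} {f} ab≡cd f-injective y = x , λ { refl → fx≡y }
  where
  unflatten : ∀ {m} n (p : Fin m × Fin n) → remQuot n (uncurry combine p) ≡ p
  unflatten n (i , j) = remQuot-combine i j
  g : Fin (a * b) → Fin (c * d)
  g = uncurry combine ∘ f ∘ remQuot b
  g-injective : Injective _≡_ _≡_ g
  g-injective {z} {z′} gz≡gz′ = begin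
    z                                   ≡⟨ combine-remQuot {a} b z ⟨
    uncurry combine (remQuot {a} b z)   ≡⟨ cong (uncurry combine) (f-injective (begin
      f (remQuot b z)                     ≡⟨ unflatten d _ ⟨
      remQuot d (g z)                     ≡⟨ cong (remQuot d) gz≡gz′ ⟩
      remQuot d (g z′)                    ≡⟨ unflatten d _ ⟩
      f (remQuot b z′)                    ∎)) ⟩
    uncurry combine (remQuot {a} b z′)  ≡⟨ combine-remQuot {a} b z′ ⟩
    z′                                  ∎
  preimage = injective⇒surjective ab≡cd g-injective (uncurry combine y)
  x = remQuot b (proj₁ preimage)
  fx≡y : f x ≡ y
  fx≡y = begin
    f x                             ≡⟨ unflatten d _ ⟨
    remQuot d (g (proj₁ preimage))  ≡⟨ cong (remQuot d) (proj₂ preimage refl) ⟩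
    remQuot d (uncurry combine y)   ≡⟨ unflatten d y ⟩
    y                               ∎

∑-permute : ∀ n (σ : ℕ → ℕ) → (∀ {t} → t < n → σ t < n) →
            (∀ {t u} → t < n → u < n → σ t ≡ σ u → t ≡ u) →
            ∀ g → ∑[ t < n ] g (σ t) ≡ ∑ n g
∑-permute n σ σ< σ-inj g = begin
  ∑[ t < n ] g (σ t)          ≡⟨ ∑≡sum n (g ∘ σ) ⟩
  Sumℕ.sum {n} (g ∘ σ ∘ toℕ)  ≡⟨ Sumℕ.sum-cong-≗ (cong g ∘ sym ∘ toℕ-σ̂) ⟩
  Sumℕ.sum {n} (g ∘ toℕ ∘ σ̂)  ≡⟨ Sumℕ.sum-permute (g ∘ toℕ) π ⟨
  Sumℕ.sum {n} (g ∘ toℕ)      ≡⟨ ∑≡sum n g ⟨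
  ∑ n g                       ∎
  where
  σ̂ : Fin n → Fin n
  σ̂ i = fromℕ< (σ< (toℕ<n i))
  toℕ-σ̂ : ∀ i → toℕ (σ̂ i) ≡ σ (toℕ i)
  toℕ-σ̂ i = toℕ-fromℕ< (σ< (toℕ<n i))
  σ̂-injective : Injective _≡_ _≡_ σ̂
  σ̂-injective {i} {j} eq = toℕ-injective (σ-inj (toℕ<n i) (toℕ<n j)
    (trans (sym (toℕ-σ̂ i)) (trans (cong toℕ eq) (toℕ-σ̂ j))))
  π = ⤖⇒↔ (mk⤖ (σ̂-injective , injective⇒surjective refl σ̂-injective))

module _ {n : ℕ} where

  reverse< : ∀ {t} → t < n → n ∸ suc t < n
  reverse< {t} (s≤s {n = n′} _) = s≤s (m∸n≤m n′ t)

  reverse-injective : ∀ {t u} → t < n → u < n → n ∸ suc t ≡ n ∸ suc u → t ≡ u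
  reverse-injective t<n u<n = suc-injective ∘ ∸-cancelˡ-≡ t<n u<n

  reverse-involutive : ∀ {t} → t < n → n ∸ suc (n ∸ suc t) ≡ t
  reverse-involutive (s≤s t≤n′) = m∸[m∸n]≡n t≤n′

∑-reverse : ∀ n (g : ℕ → ℕ) → ∑[ t < n ] g (n ∸ suc t) ≡ ∑ n g
∑-reverse n = ∑-permute n (λ t → n ∸ suc t) reverse< reverse-injective

infix 4 _≡_mod_
_≡_mod_ : ℕ → ℕ → ℕ → Set
_≡_mod_ a b K = ∃₂ λ x y → a + x * K ≡ b + y * K

%≡%⇒≡-mod : ∀ {a b} K .{{_ : NonZero K}} → a % K ≡ b % K → a ≡ b mod K
%≡%⇒≡-mod {a} {b} K eq = b / K , a / K , (begin
  a + b / K * K                 ≡⟨ cong (_+ b / K * K) (m≡m%n+[m/n]*n a K) ⟩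
  a % K + a / K * K + b / K * K ≡⟨ cong (λ r → r + a / K * K + b / K * K) eq ⟩
  b % K + a / K * K + b / K * K ≡⟨ xy∙z≈xz∙y (b % K) (a / K * K) (b / K * K) ⟩
  b % K + b / K * K + a / K * K ≡⟨ cong (_+ a / K * K) (m≡m%n+[m/n]*n b K) ⟨
  b + a / K * K                 ∎)

≡-mod⇒%≡% : ∀ {a b} K .{{_ : NonZero K}} → a ≡ b mod K → a % K ≡ b % K
≡-mod⇒%≡% {a} {b} K (x , y , eq) = begin
  a % K           ≡⟨ [m+kn]%n≡m%n a x K ⟨
  (a + x * K) % K ≡⟨ cong (_% K) eq ⟩
  (b + y * K) % K ≡⟨ [m+kn]%n≡m%n b y K ⟩
  b % K           ∎

≡-mod-+ : ∀ {a b c d K} → a ≡ b mod K → c ≡ d mod K → a + c ≡ b + d mod K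
≡-mod-+ {a} {b} {c} {d} {K} (x , y , ab) (x′ , y′ , cd) = x + x′ , y + y′ , (begin
  a + c + (x + x′) * K       ≡⟨ regroup a c x x′ K ⟩
  (a + x * K) + (c + x′ * K) ≡⟨ cong₂ _+_ ab cd ⟩
  (b + y * K) + (d + y′ * K) ≡⟨ regroup b d y y′ K ⟨
  b + d + (y + y′) * K       ∎)
  where regroup : ∀ a c x x′ K → a + c + (x + x′) * K ≡ (a + x * K) + (c + x′ * K)
        regroup = solve-∀

≡-mod-*ˡ : ∀ {a b K} c → a ≡ b mod K → c * a ≡ c * b mod K
≡-mod-*ˡ {a} {b} {K} c (x , y , eq) = c * x , c * y , (begin
  c * a + c * x * K   ≡⟨ distrib c a x K ⟩
  c * (a + x * K)     ≡⟨ cong (c *_) eq ⟩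
  c * (b + y * K)     ≡⟨ distrib c b y K ⟨
  c * b + c * y * K   ∎)
  where distrib : ∀ c a x K → c * a + c * x * K ≡ c * (a + x * K)
        distrib = solve-∀

≡-mod-cancelʳ-+ : ∀ {a b} c {K} → a + c ≡ b + c mod K → a ≡ b mod K
≡-mod-cancelʳ-+ {a} {b} c {K} (x , y , eq) = x , y , +-cancelʳ-≡ c _ _ (begin
  a + x * K + c ≡⟨ xy∙z≈xz∙y a (x * K) c ⟩
  a + c + x * K ≡⟨ eq ⟩
  b + c + y * K ≡⟨ xy∙z≈xz∙y b (y * K) c ⟨
  b + y * K + c ∎)

≡-mod-cancelˡ-+ : ∀ c {a b K} → c + a ≡ c + b mod K → a ≡ b mod K
≡-mod-cancelˡ-+ c {a} {b} {K} = ≡-mod-cancelʳ-+ c ∘ subst₂ (_≡_mod K) (+-comm c a) (+-comm c b)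

≡-mod⇒≡ : ∀ {a b K} → a < K → b < K → a ≡ b mod K → a ≡ b
≡-mod⇒≡ {a} {b} {K} a<K b<K a≡b = begin
  a     ≡⟨ m<n⇒m%n≡m a<K ⟨
  a % K ≡⟨ ≡-mod⇒%≡% K a≡b ⟩
  b % K ≡⟨ m<n⇒m%n≡m b<K ⟩
  b     ∎
  where instance _ = >-nonZero (m<n⇒0<n a<K)

digits-unique : ∀ {a a′ x x′ K} → a < K → a′ < K → a + K * x ≡ a′ + K * x′ → a ≡ a′ × x ≡ x′
digits-unique {a} {a′} {x} {x′} {K} a<K a′<K eq = a≡a′ , *-cancelˡ-≡ x x′ K {{>-nonZero (m<n⇒0<n a<K)}}
    (+-cancelˡ-≡ a _ _ (trans eq (cong (_+ K * x′) (sym a≡a′))))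
  where
  a≡a′ : a ≡ a′
  a≡a′ = ≡-mod⇒≡ a<K a′<K (x , x′ , subst₂ (λ u v → a + u ≡ a′ + v) (*-comm K x) (*-comm K x′) eq)

≡-mod-*-digits : ∀ {c c′ h h′ K P} → c < K → c′ < K → c + K * h ≡ c′ + K * h′ mod (K * P) →
                 c ≡ c′ × (h ≡ h′ mod P)
≡-mod-*-digits {c} {c′} {h} {h′} {K} {P} c<K c′<K (x , y , eq) =
  proj₁ digits , x , y , proj₂ digits
  where
  regroup : ∀ c K h x P → c + K * h + x * (K * P) ≡ c + K * (h + x * P)
  regroup = solve-∀
  digits = digits-unique c<K c′<K (trans (sym (regroup c K h x P)) (trans eq (regroup c′ K h′ y P)))

residue : (m : ℕ) .{{_ : NonZero m}} → ℕ → Fin m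
residue m x = fromℕ< (m%n<n x m)

toℕ-residue : ∀ m .{{_ : NonZero m}} x → toℕ (residue m x) ≡ x % m
toℕ-residue m x = toℕ-fromℕ< (m%n<n x m)

residue-≡-mod : ∀ m .{{_ : NonZero m}} {x y} → residue m x ≡ residue m y → x ≡ y mod m
residue-≡-mod m {x} {y} eq = %≡%⇒≡-mod m (trans (sym (toℕ-residue m x)) (trans (cong toℕ eq) (toℕ-residue m y)))

addMod-residue : ∀ m .{{_ : NonZero m}} x y → addMod m (residue m x) (residue m y) ≡ residue m (x + y)
addMod-residue m x y = toℕ-injective (begin
  toℕ (addMod m (residue m x) (residue m y))
    ≡⟨ toℕ-residue m _ ⟩
  (toℕ (residue m x) + toℕ (residue m y)) % m
    ≡⟨ cong₂ (λ a b → (a + b) % m) (toℕ-residue m x) (toℕ-residue m y) ⟩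
  (x % m + y % m) % m
    ≡⟨ %-distribˡ-+ x y m ⟨
  (x + y) % m
    ≡⟨ toℕ-residue m (x + y) ⟨
  toℕ (residue m (x + y))
    ∎)

module _ (m₁ m₂ : ℕ) .{{_ : NonZero m₁}} .{{_ : NonZero m₂}} where

  residues : ℕ → ℕ → ZZ m₁ m₂
  residues x y = residue m₁ x , residue m₂ y

  sumZZ-residues : ∀ N (h : Fin N → ZZ m₁ m₂) (f g : ℕ → ℕ) →
                   (∀ j → h j ≡ residues (f (toℕ j)) (g (toℕ j))) →
                   sumZZ m₁ m₂ N h ≡ residues (∑ N f) (∑ N g)
  sumZZ-residues zero    h f g h≡ = refl
  sumZZ-residues (suc N) h f g h≡ rewrite h≡ Fin.zero
                                        | sumZZ-residues N (h ∘ Fin.suc) (f ∘ suc) (g ∘ suc) (h≡ ∘ Fin.suc) =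
    cong₂ _,_ (addMod-residue m₁ (f 0) _) (addMod-residue m₂ (g 0) _)

module CyclicLatinSquares (r : ℕ) where

  M : ℕ
  M = suc (r + r)

  T : ℕ
  T = ∑[ t < M ] t

  T≡M*r : T ≡ M * r
  T≡M*r = *-cancelʳ-≡ T (M * r) 2 (+-cancelʳ-≡ M _ _ (trans (∑-gauss M) (square r)))
    where square : ∀ r → suc (r + r) * suc (r + r) ≡ suc (r + r) * r * 2 + suc (r + r)
          square = solve-∀

  ∑-%-injective : (σ : ℕ → ℕ) → (∀ {t u} → t < M → u < M → σ t ≡ σ u mod M → t ≡ u) →
                  ∑[ t < M ] (σ t % M) ≡ T
  ∑-%-injective σ σ-inj = ∑-permute M (λ t → σ t % M) (λ {t} _ → m%n<n (σ t) M)
    (λ t<M u<M → σ-inj t<M u<M ∘ %≡%⇒≡-mod M) id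

  -- 2 is invertible modulo the odd number M, with inverse r + 1.
  halve : ∀ {t u} → t + t ≡ u + u mod M → t ≡ u mod M
  halve {t} {u} 2t≡2u with ≡-mod-*ˡ (suc r) 2t≡2u
  ... | x , y , eq = t + x , u + y , (begin
    t + (t + x) * M          ≡⟨ inverse-of-2 r t x ⟩
    suc r * (t + t) + x * M  ≡⟨ eq ⟩
    suc r * (u + u) + y * M  ≡⟨ inverse-of-2 r u y ⟨
    u + (u + y) * M          ∎)
    where inverse-of-2 : ∀ r t x → t + (t + x) * suc (r + r) ≡ suc r * (t + t) + x * suc (r + r)
          inverse-of-2 = solve-∀

  -- The offset r + 1 makes the antidiagonal of A constant r, with sum M r = T.
  A : ℕ → ℕ → ℕ
  A p q = (p + q + suc r) % M

  B : ℕ → ℕ → ℕ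
  B p q = A p (M ∸ suc q)

  A< : ∀ p q → A p q < M
  A< p q = m%n<n (p + q + suc r) M

  complement : ∀ {q} → q < M → q + (M ∸ suc q) ≡ r + r
  complement (s≤s q≤2r) = m+[n∸m]≡n q≤2r

  A-antidiagonal : ∀ {t} → t < M → A t (M ∸ suc t) ≡ r
  A-antidiagonal {t} t<M = begin
    (t + (M ∸ suc t) + suc r) % M ≡⟨ cong (λ c → (c + suc r) % M) (complement t<M) ⟩
    (r + r + suc r) % M           ≡⟨ cong (_% M) (+-comm (r + r) (suc r)) ⟩
    (suc r + (r + r)) % M         ≡⟨ cong (_% M) (sym (+-suc r (r + r))) ⟩
    (r + M) % M                   ≡⟨ [m+n]%n≡m%n r M ⟩
    r % M                         ≡⟨ m<n⇒m%n≡m (s≤s (m≤m+n r r)) ⟩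
    r                             ∎

  ∑-A-row : ∀ p → ∑[ t < M ] A p t ≡ T
  ∑-A-row p = ∑-%-injective (λ t → p + t + suc r) λ t<M u<M →
    ≡-mod⇒≡ t<M u<M ∘ ≡-mod-cancelˡ-+ p ∘ ≡-mod-cancelʳ-+ (suc r)

  ∑-A-column : ∀ q → ∑[ t < M ] A t q ≡ T
  ∑-A-column q = ∑-%-injective (λ t → t + q + suc r) λ t<M u<M →
    ≡-mod⇒≡ t<M u<M ∘ ≡-mod-cancelʳ-+ q ∘ ≡-mod-cancelʳ-+ (suc r)

  ∑-A-diagonal : ∑[ t < M ] A t t ≡ T
  ∑-A-diagonal = ∑-%-injective (λ t → t + t + suc r) λ t<M u<M →
    ≡-mod⇒≡ t<M u<M ∘ halve ∘ ≡-mod-cancelʳ-+ (suc r)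

  ∑-A-antidiagonal : ∑[ t < M ] A t (M ∸ suc t) ≡ T
  ∑-A-antidiagonal = trans (∑-cong M A-antidiagonal) (trans (∑-const M r) (sym T≡M*r))

  ∑-B-row : ∀ p → ∑[ t < M ] B p t ≡ T
  ∑-B-row p = trans (∑-reverse M (A p)) (∑-A-row p)

  ∑-B-column : ∀ q → ∑[ t < M ] B t q ≡ T
  ∑-B-column q = ∑-A-column (M ∸ suc q)

  ∑-B-diagonal : ∑[ t < M ] B t t ≡ T
  ∑-B-diagonal = ∑-A-antidiagonal

  ∑-B-antidiagonal : ∑[ t < M ] B t (M ∸ suc t) ≡ T
  ∑-B-antidiagonal = trans (∑-cong M (λ {t} t<M → cong (A t) (reverse-involutive t<M))) ∑-A-diagonal

  A-B-orthogonal : ∀ {p q p′ q′} → p < M → q < M → p′ < M → q′ < M →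
                   A p q ≡ A p′ q′ → B p q ≡ B p′ q′ → p ≡ p′ × q ≡ q′
  A-B-orthogonal {p} {q} {p′} {q′} p<M q<M p′<M q′<M Apq≡ Bpq≡ = p≡p′ , q≡q′
    where
    s = suc r
    A≡ = %≡%⇒≡-mod M Apq≡
    A+B : ∀ p {q} → q < M → (p + q + s) + (p + (M ∸ suc q) + s) ≡ p + p + (r + r + (s + s))
    A+B p {q} q<M = trans (regroup p q (M ∸ suc q) s) (cong (λ c → p + p + (c + (s + s))) (complement q<M))
      where regroup : ∀ p q q̄ s → (p + q + s) + (p + q̄ + s) ≡ p + p + (q + q̄ + (s + s))
            regroup = solve-∀
    p≡p′ : p ≡ p′
    p≡p′ = ≡-mod⇒≡ p<M p′<M (halve (≡-mod-cancelʳ-+ (r + r + (s + s))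
      (subst₂ (_≡_mod M) (A+B p q<M) (A+B p′ q′<M)
        (≡-mod-+ {p + q + s} {p′ + q′ + s} A≡ (%≡%⇒≡-mod M Bpq≡)))))
    q≡q′ : q ≡ q′
    q≡q′ = ≡-mod⇒≡ q<M q′<M (≡-mod-cancelˡ-+ p (≡-mod-cancelʳ-+ s
      (subst (λ x → p + q + s ≡ x + q′ + s mod M) (sym p≡p′) A≡)))

data Letter : Set where
  L U X : Letter

-- Conway's 2×2 patterns; the cell (u , v) is in the lower row iff u, in the right column iff v:
--   L = 3 0    U = 0 3    X = 0 3
--       1 2        1 2        2 1
lux : Letter → Bool → Bool → Fin 4
lux L false false = 3F
lux L false true  = 0F
lux L true  false = 1F
lux L true  true  = 2F
lux U false false = 0F
lux U false true  = 3F
lux U true  false = 1F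
lux U true  true  = 2F
lux X false false = 0F
lux X false true  = 3F
lux X true  false = 2F
lux X true  true  = 1F

lux⁻¹ : Letter → Fin 4 → Bool × Bool
lux⁻¹ L 0F = false , true
lux⁻¹ L 1F = true  , false
lux⁻¹ L 2F = true  , true
lux⁻¹ L 3F = false , false
lux⁻¹ U 0F = false , false
lux⁻¹ U 1F = true  , false
lux⁻¹ U 2F = true  , true
lux⁻¹ U 3F = false , true
lux⁻¹ X 0F = false , false
lux⁻¹ X 1F = true  , true
lux⁻¹ X 2F = true  , false
lux⁻¹ X 3F = false , true

lux⁻¹-lux : ∀ τ u v → lux⁻¹ τ (lux τ u v) ≡ (u , v)
lux⁻¹-lux L false false = refl
lux⁻¹-lux L false true  = refl
lux⁻¹-lux L true  false = refl
lux⁻¹-lux L true  true  = refl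
lux⁻¹-lux U false false = refl
lux⁻¹-lux U false true  = refl
lux⁻¹-lux U true  false = refl
lux⁻¹-lux U true  true  = refl
lux⁻¹-lux X false false = refl
lux⁻¹-lux X false true  = refl
lux⁻¹-lux X true  false = refl
lux⁻¹-lux X true  true  = refl

lux-injective : ∀ τ {u v u′ v′} → lux τ u v ≡ lux τ u′ v′ → (u , v) ≡ (u′ , v′)
lux-injective τ {u} {v} {u′} {v′} eq = begin
  (u , v)                ≡⟨ lux⁻¹-lux τ u v ⟨
  lux⁻¹ τ (lux τ u v)    ≡⟨ cong (lux⁻¹ τ) eq ⟩
  lux⁻¹ τ (lux τ u′ v′)  ≡⟨ lux⁻¹-lux τ u′ v′ ⟩
  (u′ , v′)              ∎

lux-pair : Bool → Bool → Bool → Bool → Letter → ℕ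
lux-pair u₁ v₁ u₂ v₂ τ = toℕ (lux τ u₁ v₁) + toℕ (lux τ u₂ v₂)

lux-row : ∀ τ u → toℕ (lux τ u false) + toℕ (lux τ u true) ≡ 3
lux-row L false = refl
lux-row L true  = refl
lux-row U false = refl
lux-row U true  = refl
lux-row X false = refl
lux-row X true  = refl

module LUXSquare (r′ : ℕ) where

  r : ℕ
  r = suc r′

  M : ℕ
  M = suc (r + r)

  letter : ℕ → ℕ → Letter
  letter p q =
    if does (p <? r) then L
    else if does (p ≟ r) then (if does (q ≟ r) then U else L)
    else if does (p ≟ suc r) then (if does (q ≟ r) then L else U)
    else X

  digit : Bool → ℕ → Bool → ℕ → ℕ
  digit u p v q = toℕ (lux (letter p q) u v)

  letter-upper : ∀ {p} q → p < r → letter p q ≡ L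
  letter-upper {p} q p<r rewrite dec-true (p <? r) p<r = refl

  letter-centre : letter r r ≡ U
  letter-centre rewrite dec-false (r <? r) (<-irrefl refl) | dec-true (r ≟ r) refl = refl

  letter-middle : ∀ {q} → q ≢ r → letter r q ≡ L
  letter-middle {q} q≢r
    rewrite dec-false (r <? r) (<-irrefl refl) | dec-true (r ≟ r) refl | dec-false (q ≟ r) q≢r = refl

  letter-below-centre : letter (suc r) r ≡ L
  letter-below-centre
    rewrite dec-false (suc r <? r) (<-asym (n<1+n r)) | dec-false (suc r ≟ r) 1+n≢n
          | dec-true (suc r ≟ suc r) refl = refl

  letter-below-middle : ∀ {q} → q ≢ r → letter (suc r) q ≡ U
  letter-below-middle {q} q≢r
    rewrite dec-false (suc r <? r) (<-asym (n<1+n r)) | dec-false (suc r ≟ r) 1+n≢n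
          | dec-true (suc r ≟ suc r) refl | dec-false (q ≟ r) q≢r = refl

  r<lower : ∀ t → r < suc (suc r) + t
  r<lower t = s≤s (≤-trans (n≤1+n r) (m≤m+n (suc r) t))

  letter-lower : ∀ t q → letter (suc (suc r) + t) q ≡ X
  letter-lower t q
    rewrite dec-false (suc (suc r) + t <? r) (λ lt → <-asym lt (r<lower t))
          | dec-false (suc (suc r) + t ≟ r) (λ eq → <-irrefl (sym eq) (r<lower t))
          | dec-false (suc (suc r) + t ≟ suc r) (λ eq → <-irrefl (sym eq) (s≤s (m≤m+n (suc r) t))) = refl

  ∑-segments : ∀ (g : ℕ → ℕ) {a m d} → (∀ {t} → t < r → g t ≡ a) → g r + g (suc r) ≡ m →
               (∀ t → g (suc (suc r) + t) ≡ d) → ∑ M g ≡ r * a + m + r′ * d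
  ∑-segments g {a} {m} {d} upper middle lower = begin
    ∑ M g
      ≡⟨ cong (λ n → ∑ (suc n) g) (sym (+-suc r′ (suc r′))) ⟩
    ∑ (r + suc (suc r′)) g
      ≡⟨ ∑-split r (suc (suc r′)) g ⟩
    ∑ r g + (g (r + 0) + (g (r + 1) + ∑[ t < r′ ] g (r + suc (suc t))))
      ≡⟨ cong₂ (λ x y → ∑ r g + (g x + (g y + ∑[ t < r′ ] g (r + suc (suc t))))) (+-identityʳ r) (+-comm r 1) ⟩
    ∑ r g + (g r + (g (suc r) + ∑[ t < r′ ] g (r + suc (suc t))))
      ≡⟨ cong (∑ r g +_) (sym (+-assoc (g r) _ _)) ⟩
    ∑ r g + (g r + g (suc r) + ∑[ t < r′ ] g (r + suc (suc t)))
      ≡⟨ cong₂ (λ x y → x + (g r + g (suc r) + y)) (trans (∑-cong r upper) (∑-const r a))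
                                                    (trans (∑-cong r′ (λ {t} _ → lower′ t)) (∑-const r′ d)) ⟩
    r * a + (g r + g (suc r) + r′ * d)
      ≡⟨ cong (λ x → r * a + (x + r′ * d)) middle ⟩
    r * a + (m + r′ * d)
      ≡⟨ +-assoc (r * a) m _ ⟨
    r * a + m + r′ * d
      ∎
    where lower′ : ∀ t → g (r + suc (suc t)) ≡ d
          lower′ t = trans (cong g (trans (+-suc r (suc t)) (cong suc (+-suc r t)))) (lower t)

  -- Along a line the letters are r L's, a middle pair and r′ X's; as r = r′ + 1, the counts 6 and 9 give 3M.
  ∑-letters : ∀ u₁ v₁ u₂ v₂ (p q : ℕ → ℕ) {m : ℕ} → let F = lux-pair u₁ v₁ u₂ v₂ in
              (∀ {t} → t < r → letter (p t) (q t) ≡ L) →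
              F (letter (p r) (q r)) + F (letter (p (suc r)) (q (suc r))) ≡ m →
              (∀ t → letter (p (suc (suc r) + t)) (q (suc (suc r) + t)) ≡ X) →
              F L + F X ≡ 6 → F L + m ≡ 9 →
              ∑[ t < M ] digit u₁ (p t) v₁ (q t) + ∑[ t < M ] digit u₂ (p t) v₂ (q t) ≡ M * 3
  ∑-letters u₁ v₁ u₂ v₂ p q {m} upper middle lower LX≡6 Lm≡9 = begin
    ∑[ t < M ] digit u₁ (p t) v₁ (q t) + ∑[ t < M ] digit u₂ (p t) v₂ (q t)
      ≡⟨ ∑-distrib-+ M (λ t → digit u₁ (p t) v₁ (q t)) (λ t → digit u₂ (p t) v₂ (q t)) ⟨
    ∑[ t < M ] F (letter (p t) (q t))   ≡⟨ ∑-segments _ (cong F ∘ upper) middle (cong F ∘ lower) ⟩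
    suc r′ * F L + m + r′ * F X         ≡⟨ regroup r′ (F L) m (F X) ⟩
    r′ * (F L + F X) + (F L + m)        ≡⟨ cong₂ (λ x y → r′ * x + y) LX≡6 Lm≡9 ⟩
    r′ * 6 + 9                          ≡⟨ count r′ ⟩
    M * 3                               ∎
    where F = lux-pair u₁ v₁ u₂ v₂
          regroup : ∀ r′ a m d → suc r′ * a + m + r′ * d ≡ r′ * (a + d) + (a + m)
          regroup = solve-∀
          count : ∀ r′ → r′ * 6 + 9 ≡ suc (suc r′ + suc r′) * 3
          count = solve-∀

  ∑-lux-row : ∀ p u → ∑[ t < M ] digit u p false t + ∑[ t < M ] digit u p true t ≡ M * 3
  ∑-lux-row p u = begin
    ∑[ t < M ] digit u p false t + ∑[ t < M ] digit u p true t
      ≡⟨ ∑-distrib-+ M (λ t → digit u p false t) (λ t → digit u p true t) ⟨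
    ∑[ t < M ] lux-pair u false u true (letter p t)
      ≡⟨ ∑-cong M (λ {t} _ → lux-row (letter p t) u) ⟩
    ∑[ t < M ] 3
      ≡⟨ ∑-const M 3 ⟩
    M * 3 ∎

  ∑-lux-column : ∀ q v → ∑[ t < M ] digit false t v q + ∑[ t < M ] digit true t v q ≡ M * 3
  ∑-lux-column q v =
    ∑-letters false v true v id (λ _ → q) (letter-upper q) middle (λ t → letter-lower t q) (LX≡6 v) (LUL≡9 v)
    where
    F = lux-pair false v true v
    middle : F (letter r q) + F (letter (suc r) q) ≡ F U + F L
    middle with q ≟ r
    ... | yes refl = cong₂ (λ x y → F x + F y) letter-centre letter-below-centre
    ... | no q≢r   = trans (cong₂ (λ x y → F x + F y) (letter-middle q≢r) (letter-below-middle q≢r))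
                           (+-comm (F L) (F U))
    LX≡6 : ∀ v → lux-pair false v true v L + lux-pair false v true v X ≡ 6
    LX≡6 false = refl
    LX≡6 true  = refl
    LUL≡9 : ∀ v → let F = lux-pair false v true v in F L + (F U + F L) ≡ 9
    LUL≡9 false = refl
    LUL≡9 true  = refl

  ∑-lux-diagonal : ∑[ t < M ] digit false t false t + ∑[ t < M ] digit true t true t ≡ M * 3
  ∑-lux-diagonal = ∑-letters false false true true id id (λ {t} → letter-upper t)
    (cong₂ (λ x y → lux-pair false false true true x + lux-pair false false true true y)
      letter-centre (letter-below-middle 1+n≢n))
    (λ t → letter-lower t (suc (suc r) + t)) refl refl

  ∑-lux-antidiagonal : ∑[ t < M ] digit false t true (M ∸ suc t)
                     + ∑[ t < M ] digit true t false (M ∸ suc t) ≡ M * 3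
  ∑-lux-antidiagonal = ∑-letters false true true false id (λ t → M ∸ suc t) (λ {t} → letter-upper (M ∸ suc t))
    (cong₂ (λ x y → lux-pair false true true false x + lux-pair false true true false y)
      (trans (cong (letter r) (m+n∸m≡n r r)) letter-centre)
      (trans (cong (letter (suc r)) (m+n∸n≡m r′ r)) (letter-below-middle (λ r′≡r → 1+n≢n (sym r′≡r)))))
    (λ t → letter-lower t (M ∸ suc (suc (suc r) + t))) refl refl

mixed-radix-injective : ∀ {D M P Q x y x′ y′} → M ≡ D * Q → P ≡ D * M →
                        x < M → y < M → x′ < M → y′ < M →
                        x + D * y ≡ x′ + D * y′ mod P → y ≡ y′ mod Q → x ≡ x′ × y ≡ y′
mixed-radix-injective {D} {_} {_} {Q} {x} {y} {x′} {y′} refl refl x<M y<M x′<M y′<M xy≡ y≡y′ =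
  x≡x′ , (begin
    y                   ≡⟨ m≡m%n+[m/n]*n y Q ⟩
    y % Q + y / Q * Q   ≡⟨ cong₂ (λ b t → b + t * Q) y%≡y′% y/≡y′/ ⟩
    y′ % Q + y′ / Q * Q ≡⟨ m≡m%n+[m/n]*n y′ Q ⟨
    y′                  ∎)
  where
  M = D * Q
  instance _ = m*n≢0⇒n≢0 D {{>-nonZero (m<n⇒0<n y<M)}}
  y%≡y′% : y % Q ≡ y′ % Q
  y%≡y′% = ≡-mod⇒%≡% Q y≡y′
  -- Writing y = y % Q + (y / Q) Q splits x + D y into the digit x + M (y / Q) < D M and D (y % Q).
  split : ∀ x y → x + D * y ≡ x + M * (y / Q) + D * (y % Q)
  split x y = trans (cong (λ z → x + D * z) (m≡m%n+[m/n]*n y Q)) (regroup x D (y % Q) (y / Q) Q)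
    where regroup : ∀ x D b t Q → x + D * (b + t * Q) ≡ x + D * Q * t + D * b
          regroup = solve-∀
  digit< : ∀ {x y} → x < M → y < M → x + M * (y / Q) < D * M
  digit< {x} {y} x<M y<M = <-≤-trans (+-monoˡ-< (M * (y / Q)) x<M)
    (subst₂ _≤_ (*-suc M (y / Q)) (*-comm M D) (*-monoʳ-≤ M (m<n*o⇒m/o<n y<M)))
  digits : x ≡ x′ × y / Q ≡ y′ / Q
  digits = digits-unique x<M x′<M (≡-mod⇒≡ (digit< x<M y<M) (digit< x′<M y′<M)
    (≡-mod-cancelʳ-+ (D * (y % Q))
      (subst₂ (_≡_mod (D * M)) (split x y)
        (trans (split x′ y′) (cong (λ b → x′ + M * (y′ / Q) + D * b) (sym y%≡y′%))) xy≡)))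
  x≡x′ = proj₁ digits
  y/≡y′/ = proj₂ digits

record LinearEmbedding (M P Q : ℕ) : Set where
  field
    a₁ b₁ a₂ b₂ : ℕ
    injective : ∀ {x y x′ y′} → x < M → y < M → x′ < M → y′ < M →
                a₁ * x + b₁ * y ≡ a₁ * x′ + b₁ * y′ mod P →
                a₂ * x + b₂ * y ≡ a₂ * x′ + b₂ * y′ mod Q → x ≡ x′ × y ≡ y′

  ℓ₁ ℓ₂ : ℕ → ℕ → ℕ
  ℓ₁ x y = a₁ * x + b₁ * y
  ℓ₂ x y = a₂ * x + b₂ * y

swap-embedding : ∀ {M P Q} → LinearEmbedding M Q P → LinearEmbedding M P Q
swap-embedding e = record
  { a₁ = a₂ ; b₁ = b₂ ; a₂ = a₁ ; b₂ = b₁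
  ; injective = λ x<M y<M x′<M y′<M ℓ₁≡ ℓ₂≡ → injective x<M y<M x′<M y′<M ℓ₂≡ ℓ₁≡
  }
  where open LinearEmbedding e

mixed-radix-embedding : ∀ {M P Q} D → M ≡ D * Q → P ≡ D * M → LinearEmbedding M P Q
mixed-radix-embedding {M} {P} {Q} D M≡DQ P≡DM = record
  { a₁ = 1 ; b₁ = D ; a₂ = 0 ; b₂ = 1
  ; injective = λ {x} {y} {x′} {y′} x<M y<M x′<M y′<M ℓ₁≡ ℓ₂≡ →
      mixed-radix-injective {D} M≡DQ P≡DM x<M y<M x′<M y′<M
        (subst₂ (λ a b → a + D * y ≡ b + D * y′ mod P) (+-identityʳ x) (+-identityʳ x′) ℓ₁≡)
        (subst₂ (_≡_mod Q) (+-identityʳ y) (+-identityʳ y′) ℓ₂≡)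
  }

power-embedding : ∀ n {a b k} → a + b ≡ k + k → k ≤ a → LinearEmbedding (n ^ k) (n ^ a) (n ^ b)
power-embedding n {a} {b} {k} a+b≡k+k k≤a = mixed-radix-embedding (n ^ d) nᵏ≡nᵈnᵇ nᵃ≡nᵈnᵏ
  where
  d = a ∸ k
  a≡d+k : a ≡ d + k
  a≡d+k = sym (m∸n+n≡m k≤a)
  d+b≡k : d + b ≡ k
  d+b≡k = +-cancelʳ-≡ k _ _ (begin
    d + b + k   ≡⟨ xy∙z≈xz∙y d b k ⟩
    d + k + b   ≡⟨ cong (_+ b) a≡d+k ⟨
    a + b       ≡⟨ a+b≡k+k ⟩
    k + k       ∎)
  nᵏ≡nᵈnᵇ : n ^ k ≡ n ^ d * n ^ b
  nᵏ≡nᵈnᵇ = trans (cong (n ^_) (sym d+b≡k)) (^-distribˡ-+-* n d b)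
  nᵃ≡nᵈnᵏ : n ^ a ≡ n ^ d * n ^ k
  nᵃ≡nᵈnᵏ = trans (cong (n ^_) a≡d+k) (^-distribˡ-+-* n d k)

balanced-power-embedding : ∀ n {α β k} → α + β ≡ k + k → LinearEmbedding (n ^ k) (n ^ α) (n ^ β)
balanced-power-embedding n {α} {β} {k} α+β≡k+k with k ≤? α
... | yes k≤α = power-embedding n α+β≡k+k k≤α
... | no  k≰α = swap-embedding (power-embedding n (trans (+-comm β α) α+β≡k+k) k≤β)
  where k≤β : k ≤ β
        k≤β = ≮⇒≥ (λ β<k → <-irrefl α+β≡k+k (+-mono-< (≰⇒> k≰α) β<k))

^-balanced : ∀ n {a b k} → a + b ≡ k + k → n ^ a * n ^ b ≡ n ^ k * n ^ k
^-balanced n {a} {b} {k} a+b≡k+k = begin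
  n ^ a * n ^ b  ≡⟨ ^-distribˡ-+-* n a b ⟨
  n ^ (a + b)    ≡⟨ cong (n ^_) a+b≡k+k ⟩
  n ^ (k + k)    ≡⟨ ^-distribˡ-+-* n k k ⟩
  n ^ k * n ^ k  ∎

odd-power : ∀ m j → ∃ λ t → (1 + 2 * m) ^ j ≡ 1 + 2 * t
odd-power m zero    = 0 , refl
odd-power m (suc j) with odd-power m j
... | t , eq = m + t + 2 * m * t , trans (cong ((1 + 2 * m) *_) eq) (product m t)
  where product : ∀ m t → (1 + 2 * m) * (1 + 2 * t) ≡ 1 + 2 * (m + t + 2 * m * t)
        product = solve-∀

odd-power-≥3 : ∀ m′ j → ∃ λ r′ → (1 + 2 * suc m′) ^ suc j ≡ suc (suc r′ + suc r′)
odd-power-≥3 m′ j with odd-power (suc m′) j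
... | t , eq = m′ + t + 2 * suc m′ * t , trans (cong ((1 + 2 * suc m′) *_) eq) (product m′ t)
  where product : ∀ m′ t → let r′ = m′ + t + 2 * suc m′ * t in
                  (1 + 2 * suc m′) * (1 + 2 * t) ≡ suc (suc r′ + suc r′)
        product = solve-∀

module Construction (r′ : ℕ) {P Q : ℕ} .{{_ : NonZero (4 * P)}} .{{_ : NonZero Q}}
                    (embedding : LinearEmbedding (suc (suc r′ + suc r′)) P Q) where

  open CyclicLatinSquares (suc r′)
  open LUXSquare r′ using (letter; digit; ∑-lux-row; ∑-lux-column; ∑-lux-diagonal; ∑-lux-antidiagonal)
  open LinearEmbedding embedding

  N : ℕ
  N = 2 * M

  -- Cell (u , v) of block (p , q); its LUX digit is the unit digit in base 4 of the first coordinate.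
  value₁ value₂ : Bool × ℕ → Bool × ℕ → ℕ
  value₁ (u , p) (v , q) = digit u p v q + 4 * ℓ₁ (A p q) (B p q)
  value₂ (u , p) (v , q) = ℓ₂ (A p q) (B p q)

  μ₁ μ₂ : ℕ
  μ₁ = M * 3 + 4 * ℓ₁ T T + 4 * ℓ₁ T T
  μ₂ = ℓ₂ T T + ℓ₂ T T

  record Balanced (p q : ℕ → ℕ) : Set where
    constructor balanced
    field
      ∑-A : ∑[ t < M ] A (p t) (q t) ≡ T
      ∑-B : ∑[ t < M ] B (p t) (q t) ≡ T

  row-balanced : ∀ p → Balanced (λ _ → p) id
  row-balanced p = balanced (∑-A-row p) (∑-B-row p)

  column-balanced : ∀ q → Balanced id (λ _ → q)
  column-balanced q = balanced (∑-A-column q) (∑-B-column q)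

  diagonal-balanced : Balanced id id
  diagonal-balanced = balanced ∑-A-diagonal ∑-B-diagonal

  antidiagonal-balanced : Balanced id (λ t → M ∸ suc t)
  antidiagonal-balanced = balanced ∑-A-antidiagonal ∑-B-antidiagonal

  ∑-linear : ∀ {p q} → Balanced p q → ∀ a b → ∑[ t < M ] (a * A (p t) (q t) + b * B (p t) (q t)) ≡ a * T + b * T
  ∑-linear {p} {q} (balanced ∑A ∑B) a b = begin
    ∑[ t < M ] (a * A (p t) (q t) + b * B (p t) (q t))
      ≡⟨ ∑-distrib-+ M (λ t → a * A (p t) (q t)) (λ t → b * B (p t) (q t)) ⟩
    ∑[ t < M ] (a * A (p t) (q t)) + ∑[ t < M ] (b * B (p t) (q t))
      ≡⟨ cong₂ _+_ (∑-*ˡ M a (λ t → A (p t) (q t))) (∑-*ˡ M b (λ t → B (p t) (q t))) ⟩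
    a * ∑[ t < M ] A (p t) (q t) + b * ∑[ t < M ] B (p t) (q t)
      ≡⟨ cong₂ (λ x y → a * x + b * y) ∑A ∑B ⟩
    a * T + b * T ∎

  ∑-value₁ : ∀ u v {p q} → Balanced p q →
             ∑[ t < M ] value₁ (u , p t) (v , q t) ≡ ∑[ t < M ] digit u (p t) v (q t) + 4 * ℓ₁ T T
  ∑-value₁ u v {p} {q} pq = begin
    ∑[ t < M ] value₁ (u , p t) (v , q t)
      ≡⟨ ∑-distrib-+ M (λ t → digit u (p t) v (q t)) (λ t → 4 * ℓ₁ (A (p t) (q t)) (B (p t) (q t))) ⟩
    ∑[ t < M ] digit u (p t) v (q t) + ∑[ t < M ] (4 * ℓ₁ (A (p t) (q t)) (B (p t) (q t)))
      ≡⟨ cong (∑[ t < M ] digit u (p t) v (q t) +_)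
           (trans (∑-*ˡ M 4 (λ t → ℓ₁ (A (p t) (q t)) (B (p t) (q t)))) (cong (4 *_) (∑-linear pq a₁ b₁))) ⟩
    ∑[ t < M ] digit u (p t) v (q t) + 4 * ℓ₁ T T ∎

  MagicSums : ℕ → ℕ → Set
  MagicSums s₁ s₂ = s₁ ≡ μ₁ × s₂ ≡ μ₂

  -- A line of the big square runs through the same line of the square of blocks twice, once in each half.

  ∑-line : ∀ u₁ v₁ u₂ v₂ {p₁ q₁ p₂ q₂} → Balanced p₁ q₁ → Balanced p₂ q₂ →
           ∑[ t < M ] digit u₁ (p₁ t) v₁ (q₁ t) + ∑[ t < M ] digit u₂ (p₂ t) v₂ (q₂ t) ≡ M * 3 →
           MagicSums (∑[ t < M ] value₁ (u₁ , p₁ t) (v₁ , q₁ t) + ∑[ t < M ] value₁ (u₂ , p₂ t) (v₂ , q₂ t))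
                     (∑[ t < M ] value₂ (u₁ , p₁ t) (v₁ , q₁ t) + ∑[ t < M ] value₂ (u₂ , p₂ t) (v₂ , q₂ t))
  ∑-line u₁ v₁ u₂ v₂ {p₁} {q₁} pq₁ pq₂ ∑lux =
    trans (cong₂ _+_ (∑-value₁ u₁ v₁ pq₁) (∑-value₁ u₂ v₂ pq₂))
          (trans (regroup (∑[ t < M ] digit u₁ (p₁ t) v₁ (q₁ t)) _ (4 * ℓ₁ T T))
                 (cong (λ c → c + 4 * ℓ₁ T T + 4 * ℓ₁ T T) ∑lux)) ,
    cong₂ _+_ (∑-linear pq₁ a₂ b₂) (∑-linear pq₂ a₂ b₂)
    where regroup : ∀ c₁ c₂ h → c₁ + h + (c₂ + h) ≡ c₁ + c₂ + h + h
          regroup = solve-∀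

  N≡M+M : N ≡ M + M
  N≡M+M = cong (M +_) (+-identityʳ M)

  -- Row (column) i of the big square meets the blocks of row (column) i mod M of the square of blocks,
  -- in their lower row (right column) iff M ≤ i.
  block : ℕ → Bool × ℕ
  block i = if does (M ≤? i) then (true , i ∸ M) else (false , i)

  unblock : Bool × ℕ → ℕ
  unblock (false , p) = p
  unblock (true  , p) = M + p

  block-low : ∀ {t} → t < M → block t ≡ (false , t)
  block-low {t} t<M rewrite dec-false (M ≤? t) (<⇒≱ t<M) = refl

  block-high : ∀ t → block (M + t) ≡ (true , t)
  block-high t rewrite dec-true (M ≤? M + t) (m≤m+n M t) = cong (true ,_) (m+n∸m≡n M t)

  unblock-block : ∀ i → unblock (block i) ≡ i
  unblock-block i with M ≤? i
  ... | yes M≤i rewrite dec-true  (M ≤? i) M≤i = m+[n∸m]≡n M≤i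
  ... | no  M≰i rewrite dec-false (M ≤? i) M≰i = refl

  block< : ∀ {i} → i < N → proj₂ (block i) < M
  block< {i} i<N with M ≤? i
  ... | yes M≤i rewrite dec-true  (M ≤? i) M≤i =
    subst (i ∸ M <_) (m+n∸m≡n M M) (∸-monoˡ-< (subst (i <_) N≡M+M i<N) M≤i)
  ... | no  M≰i rewrite dec-false (M ≤? i) M≰i = ≰⇒> M≰i

  reverse-low : ∀ {t} → t < M → N ∸ suc t ≡ M + (M ∸ suc t)
  reverse-low {t} t<M = trans (cong (_∸ suc t) N≡M+M) (+-∸-assoc M t<M)

  reverse-high : ∀ t → N ∸ suc (M + t) ≡ M ∸ suc t
  reverse-high t = begin
    N ∸ suc (M + t)     ≡⟨ cong₂ _∸_ N≡M+M (sym (+-suc M t)) ⟩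
    M + M ∸ (M + suc t) ≡⟨ [m+n]∸[m+o]≡n∸o M M (suc t) ⟩
    M ∸ suc t           ∎

  ∑-halves : ∀ (g : ℕ → ℕ) → ∑ N g ≡ ∑ M g + ∑[ t < M ] g (M + t)
  ∑-halves g = trans (cong (λ n → ∑ n g) N≡M+M) (∑-split M M g)

  ∑-blocks : ∀ (F : Bool × ℕ → ℕ) → ∑[ i < N ] F (block i) ≡ ∑[ t < M ] F (false , t) + ∑[ t < M ] F (true , t)
  ∑-blocks F = trans (∑-halves (F ∘ block))
    (cong₂ _+_ (∑-cong M (cong F ∘ block-low)) (∑-cong M (λ {t} _ → cong F (block-high t))))

  square₁ square₂ : ℕ → ℕ → ℕ
  square₁ i j = value₁ (block i) (block j)
  square₂ i j = value₂ (block i) (block j)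

  row-sums : ∀ i → MagicSums (∑[ j < N ] square₁ i j) (∑[ j < N ] square₂ i j)
  row-sums i with block i
  ... | u , p = subst₂ MagicSums (sym (∑-blocks (value₁ (u , p)))) (sym (∑-blocks (value₂ (u , p))))
    (∑-line u false u true (row-balanced p) (row-balanced p) (∑-lux-row p u))

  column-sums : ∀ j → MagicSums (∑[ i < N ] square₁ i j) (∑[ i < N ] square₂ i j)
  column-sums j with block j
  ... | v , q = subst₂ MagicSums (sym (∑-blocks (λ b → value₁ b (v , q)))) (sym (∑-blocks (λ b → value₂ b (v , q))))
    (∑-line false v true v (column-balanced q) (column-balanced q) (∑-lux-column q v))

  diagonal-sums : MagicSums (∑[ i < N ] square₁ i i) (∑[ i < N ] square₂ i i)
  diagonal-sums = subst₂ MagicSums (sym (∑-blocks (λ b → value₁ b b))) (sym (∑-blocks (λ b → value₂ b b)))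
    (∑-line false false true true diagonal-balanced diagonal-balanced ∑-lux-diagonal)

  ∑-antidiagonal : ∀ (F : Bool × ℕ → Bool × ℕ → ℕ) →
                   ∑[ i < N ] F (block i) (block (N ∸ suc i)) ≡
                   ∑[ t < M ] F (false , t) (true , M ∸ suc t) + ∑[ t < M ] F (true , t) (false , M ∸ suc t)
  ∑-antidiagonal F = trans (∑-halves (λ i → F (block i) (block (N ∸ suc i)))) (cong₂ _+_
    (∑-cong M (λ t<M → cong₂ F (block-low t<M) (trans (cong block (reverse-low t<M)) (block-high _))))
    (∑-cong M (λ {t} t<M → cong₂ F (block-high t) (trans (cong block (reverse-high t)) (block-low (reverse< t<M))))))

  antidiagonal-sums : MagicSums (∑[ i < N ] square₁ i (N ∸ suc i))
                                (∑[ i < N ] square₂ i (N ∸ suc i))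
  antidiagonal-sums = subst₂ MagicSums (sym (∑-antidiagonal value₁)) (sym (∑-antidiagonal value₂))
    (∑-line false true true false antidiagonal-balanced antidiagonal-balanced ∑-lux-antidiagonal)

  value-injective : ∀ {u p v q u′ p′ v′ q′} → p < M → q < M → p′ < M → q′ < M →
                    value₁ (u , p) (v , q) ≡ value₁ (u′ , p′) (v′ , q′) mod (4 * P) →
                    value₂ (u , p) (v , q) ≡ value₂ (u′ , p′) (v′ , q′) mod Q →
                    (u , p) ≡ (u′ , p′) × (v , q) ≡ (v′ , q′)
  value-injective {u} {p} {v} {q} {u′} {p′} {v′} {q′} p<M q<M p′<M q′<M ≡₁ ≡₂ =
    cong₂ _,_ (cong proj₁ uv≡) p≡p′ , cong₂ _,_ (cong proj₂ uv≡) q≡q′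
    where
    digits = ≡-mod-*-digits (toℕ<n (lux (letter p q) u v)) (toℕ<n (lux (letter p′ q′) u′ v′)) ≡₁
    AB≡ = injective (A< p q) (A< p _) (A< p′ q′) (A< p′ _) (proj₂ digits) ≡₂
    pq≡ = A-B-orthogonal p<M q<M p′<M q′<M (proj₁ AB≡) (proj₂ AB≡)
    p≡p′ = proj₁ pq≡
    q≡q′ = proj₂ pq≡
    uv≡ : (u , v) ≡ (u′ , v′)
    uv≡ = lux-injective (letter p q) (toℕ-injective (trans (proj₁ digits)
            (cong₂ (λ p q → digit u′ p v′ q) (sym p≡p′) (sym q≡q′))))

  entry : Fin N × Fin N → ZZ (4 * P) Q
  entry (i , j) = residues (4 * P) Q (square₁ (toℕ i) (toℕ j)) (square₂ (toℕ i) (toℕ j))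

  entry-injective : Injective _≡_ _≡_ entry
  entry-injective {i , j} {i′ , j′} entry≡ =
    cong₂ _,_ (unblock-injective (proj₁ blocks≡)) (unblock-injective (proj₂ blocks≡))
    where
    blocks≡ = value-injective (block< (toℕ<n i)) (block< (toℕ<n j)) (block< (toℕ<n i′)) (block< (toℕ<n j′))
                (residue-≡-mod (4 * P) (cong proj₁ entry≡)) (residue-≡-mod Q (cong proj₂ entry≡))
    unblock-injective : ∀ {k k′ : Fin N} → block (toℕ k) ≡ block (toℕ k′) → k ≡ k′
    unblock-injective {k} {k′} eq = toℕ-injective
      (trans (sym (unblock-block (toℕ k))) (trans (cong unblock eq) (unblock-block (toℕ k′))))

  magic-square : P * Q ≡ M * M → MagicSquare (4 * P) Q N
  magic-square PQ≡MM = record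
    { entry    = entry
    ; bij      = entry-injective , injective⇒surjective-× N²≡4PQ entry-injective
    ; μ        = residues (4 * P) Q μ₁ μ₂
    ; rows     = λ i → reduce (square₁ (toℕ i)) (square₂ (toℕ i)) (row-sums (toℕ i)) λ _ → refl
    ; cols     = λ j → reduce (λ i → square₁ i (toℕ j)) (λ i → square₂ i (toℕ j)) (column-sums (toℕ j)) λ _ → refl
    ; diag     = reduce (λ i → square₁ i i) (λ i → square₂ i i) diagonal-sums λ _ → refl
    ; antidiag = reduce (λ i → square₁ i (N ∸ suc i)) (λ i → square₂ i (N ∸ suc i)) antidiagonal-sums λ i →
                   cong (λ k → residues (4 * P) Q (square₁ (toℕ i) k) (square₂ (toℕ i) k)) (opposite-prop i)
    }
    where
    N²≡4PQ : N * N ≡ 4 * P * Q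
    N²≡4PQ = begin
      2 * M * (2 * M) ≡⟨ square-double M ⟩
      4 * (M * M)     ≡⟨ cong (4 *_) PQ≡MM ⟨
      4 * (P * Q)     ≡⟨ *-assoc 4 P Q ⟨
      4 * P * Q       ∎
      where square-double : ∀ M → 2 * M * (2 * M) ≡ 4 * (M * M)
            square-double = solve-∀
    reduce : ∀ (f g : ℕ → ℕ) {h : Fin N → ZZ (4 * P) Q} → MagicSums (∑ N f) (∑ N g) →
             (∀ j → h j ≡ residues (4 * P) Q (f (toℕ j)) (g (toℕ j))) →
             sumZZ (4 * P) Q N h ≡ residues (4 * P) Q μ₁ μ₂
    reduce f g {h} (∑f≡ , ∑g≡) h≡ =
      trans (sumZZ-residues (4 * P) Q N h f g h≡) (cong₂ (residues (4 * P) Q) ∑f≡ ∑g≡)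

lemma5p5 : (n α β k : ℕ) → (∃ λ m → n ≡ 1 + 2 * m) → 1 < n →
           1 ≤ α → 1 ≤ β → α + β ≡ 2 * k →
           .{{_ : NonZero (4 * n ^ α)}} → .{{_ : NonZero (n ^ β)}} →
           MagicSquare (4 * n ^ α) (n ^ β) (2 * n ^ k)
lemma5p5 _ α β k (zero , refl) (s≤s ()) _ _ _
lemma5p5 _ (suc α) β zero _ _ _ _ ()
lemma5p5 n α β (suc k) (suc m′ , refl) _ _ _ α+β≡2k =
  subst (λ M → MagicSquare (4 * n ^ α) (n ^ β) (2 * M)) (sym nᵏ≡M)
    (Construction.magic-square r′ (subst (λ M → LinearEmbedding M (n ^ α) (n ^ β)) nᵏ≡M embedding)
      (trans (^-balanced n {α} {β} {suc k} α+β≡k+k) (cong₂ _*_ nᵏ≡M nᵏ≡M)))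
  where
  r′ = proj₁ (odd-power-≥3 m′ k)
  nᵏ≡M : n ^ suc k ≡ suc (suc r′ + suc r′)
  nᵏ≡M = proj₂ (odd-power-≥3 m′ k)
  α+β≡k+k : α + β ≡ suc k + suc k
  α+β≡k+k = trans α+β≡2k (cong (suc k +_) (+-identityʳ (suc k)))
  embedding : LinearEmbedding (n ^ suc k) (n ^ α) (n ^ β)
  embedding = balanced-power-embedding n {α} {β} α+β≡k+k
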